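{- The following hold: (1) For every $s\in2^{<\omega}$, $\mathcal{F}_{[s]}$ is the Fréchet filter, where $[s]=\{x\in2^\omega:s\subseteq x\}$. (2) For every nonempty open set $X\subseteq2^\omega$, $\mathcal{F}_X$ is the Fréchet filter. (3) For every $X\subseteq2^\omega$ with nonempty interior, $\mathcal{F}_X$ is the Fréchet filter.
   Context: $2^\omega$ carries the product (Cantor) topology. The Fréchet filter is the collection of cofinite subsets of $\omega$. Subsets of $\omega$ are identified with elements of $2^\omega$. For distinct $x,y\in2^\omega$ let $h(x,y)=\min\{n:x(n)\ne y(n)\}$; for $X\subseteq2^\omega$, $H(X)=\{h(x,y):x,y\in X,x\ne y\}$. The Raisonnier filter $\mathcal{F}_X$ is the set of all $a\subseteq\omega$ for which there is a countable family $\{Y_n:n<\omega\}$ of subsets of $2^\omega$ with $X\subseteq\bigcup_nY_n$ and $a\supseteq\bigcup_nH(Y_n)$. -}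

module Defs where

open import Data.Nat using (ℕ; zero; suc; _≤_; _<_)
open import Data.Bool using (Bool; true; false)
open import Data.List using (List; []; _∷_)
open import Data.Unit using (⊤)
open import Data.Product using (Σ; _×_; ∃)
open import Relation.Nullary using (¬_; Dec)
open import Relation.Binary.PropositionalEquality using (_≡_; _≢_)

Cantor : Set
Cantor = ℕ → Bool

SubsetC : Set₁
SubsetC = Cantor → Set

-- Subsets of ω, identified with elements of 2^ω.
Subω : Set
Subω = Cantor

_⊆C_ : SubsetC → SubsetC → Set
X ⊆C Y = ∀ x → X x → Y x

Extends : List Bool → Cantor → Set
Extends []      x = ⊤
Extends (b ∷ s) x = (x 0 ≡ b) × Extends s (λ n → x (suc n))

Cone : List Bool → SubsetC
Cone s x = Extends s x

IsH : Cantor → Cantor → ℕ → Set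
IsH x y n = (x ≢ y) × (∀ i → i < n → x i ≡ y i) × (x n ≢ y n)

H : SubsetC → ℕ → Set
H Y n = Σ Cantor λ x → Σ Cantor λ y → Y x × Y y × IsH x y n

Raisonnier : SubsetC → Subω → Set₁
Raisonnier X a =
  Σ (ℕ → SubsetC) λ Y →
    (∀ x → X x → ∃ λ n → Y n x) ×
    (∀ n m → H (Y n) m → a m ≡ true)

-- Cofinite subsets of ω (the Fréchet filter): the complement is finite,
-- i.e. bounded.
Cofinite : Subω → Set
Cofinite a = Σ ℕ λ N → ∀ n → N ≤ n → a n ≡ true

IsFrechet : SubsetC → Set₁
IsFrechet X = ∀ a → (Raisonnier X a → Cofinite a) × (Cofinite a → Raisonnier X a)

IsOpen : SubsetC → Set
IsOpen X = ∀ x → X x → Σ (List Bool) λ s → Cone s x × (Cone s ⊆C X)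

Nonempty : SubsetC → Set
Nonempty X = Σ Cantor λ x → X x

Interior : SubsetC → Cantor → Set₁
Interior X x = Σ SubsetC λ U → IsOpen U × U x × (U ⊆C X)

NonemptyInterior : SubsetC → Set₁
NonemptyInterior X = Σ Cantor λ x → Interior X x

-- Law of excluded middle (the paper works classically).
LEM : Set₁
LEM = (P : Set) → Dec P

{-# OPTIONS --safe #-}
-- Every F_X contains the Fréchet filter: if a contains all n ≥ N, cover X by the countably many
-- sets of points sharing their first N bits; each of these has H inside [N, ∞).
-- Conversely, suppose a ∈ F_[s] via a cover (Y_k) but a misses infinitely many numbers
-- |s| ≤ b₀ < b₁ < ⋯.  Build x ∈ [s] bit by bit, fixing x(b_k) at stage k: if some y ∈ Y_k
-- agrees with x below b_k and has y(b_k) = 1, let x(b_k) = 0, so that h(x, y) = b_k ∉ a and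
-- x ∉ Y_k; otherwise let x(b_k) = 1, and again x ∉ Y_k, since x itself would be such a y.
-- So x escapes the cover.  Every nonempty open set, hence every set with nonempty interior,
-- contains a cone [s], and F_X only grows as X shrinks.
module Submission where

open import Defs
open import Data.Bool using (Bool; true; false; not)
open import Data.List using (List; []; _∷_; length)
open import Data.Nat using (ℕ; zero; suc; _≤_; _<_; _≤′_; ≤′-refl; ≤′-step; z≤n; s≤s; _≟_)
open import Data.Nat.Properties
  using (≤-refl; ≤-trans; ≤-total; <⇒≤; <⇒≢; <-≤-trans; ≮⇒≥; ≤⇒≤′; m<1+n⇒m<n∨m≡n)
open import Data.Nat.Binary using (ℕᵇ; zero; 2[1+_]; 1+[2_]; toℕ)
open import Data.Nat.Binary.Properties using (toℕ-injective)
open import Data.Product using (Σ; ∃; _×_; _,_; proj₁; proj₂)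
open import Data.Sum using (inj₁; inj₂)
open import Data.Unit using (tt)
open import Relation.Nullary using (¬_; yes; no; does; contradiction)
open import Relation.Nullary.Decidable using (dec-true; dec-false)
open import Relation.Binary.PropositionalEquality using (_≡_; _≢_; refl; sym; trans; cong)

Agree : ℕ → Cantor → Cantor → Set
Agree n x y = ∀ i → i < n → x i ≡ y i

agree⇒IsH : ∀ {n x y} → Agree n x y → x n ≢ y n → IsH x y n
agree⇒IsH {n} agree xn≢yn = (λ x≡y → xn≢yn (cong (λ z → z n) x≡y)) , agree , xn≢yn

_++ᶜ_ : List Bool → Cantor → Cantor
([]    ++ᶜ z) n       = z n
((b ∷ s) ++ᶜ z) zero    = b
((b ∷ s) ++ᶜ z) (suc n) = (s ++ᶜ z) n

extends-++ᶜ : ∀ s z → Extends s (s ++ᶜ z)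
extends-++ᶜ []      z = tt
extends-++ᶜ (b ∷ s) z = refl , extends-++ᶜ s z

extends-agree : ∀ s {x y} → Extends s x → Agree (length s) x y → Extends s y
extends-agree []      _            _     = tt
extends-agree (b ∷ s) (x₀≡b , ext) agree =
  trans (sym (agree 0 (s≤s z≤n))) x₀≡b ,
  extends-agree s ext (λ i i<|s| → agree (suc i) (s≤s i<|s|))

update : Cantor → ℕ → Bool → Cantor
update x p c i with i ≟ p
... | yes _ = c
... | no  _ = x i

update-same : ∀ x p c → update x p c p ≡ c
update-same x p c with p ≟ p
... | yes _   = refl
... | no  p≢p = contradiction refl p≢p

update-other : ∀ x p c i → i ≢ p → update x p c i ≡ x i
update-other x p c i i≢p with i ≟ p
... | yes i≡p = contradiction i≡p i≢p
... | no  _   = refl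

-- In bijective binary numerals distinct constructor strings denote distinct numbers, so
-- initial segments are coded injectively, with no trouble from leading zeros.
push : Bool → ℕᵇ → ℕᵇ
push false = 2[1+_]
push true  = 1+[2_]

push-injective : ∀ {b b′ c c′} → push b c ≡ push b′ c′ → b ≡ b′ × c ≡ c′
push-injective {false} {false} refl = refl , refl
push-injective {true}  {true}  refl = refl , refl
push-injective {false} {true}  ()
push-injective {true}  {false} ()

prefixCode : ℕ → Cantor → ℕᵇ
prefixCode zero    x = zero
prefixCode (suc n) x = push (x n) (prefixCode n x)

prefixCode≡⇒agree : ∀ n {x y} → prefixCode n x ≡ prefixCode n y → Agree n x y
prefixCode≡⇒agree (suc n) eq i i<1+n with push-injective eq | m<1+n⇒m<n∨m≡n i<1+n
... | _     , eq′ | inj₁ i<n  = prefixCode≡⇒agree n eq′ i i<n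
... | xn≡yn , _   | inj₂ refl = xn≡yn

cofinite⇒raisonnier : ∀ X {a} → Cofinite a → Raisonnier X a
cofinite⇒raisonnier X (N , a-above-N) =
  (λ n x → toℕ (prefixCode N x) ≡ n) , (λ x _ → _ , refl) ,
  λ { n m (x , y , x∈Yn , y∈Yn , _ , _ , xm≢ym) →
        a-above-N m (≮⇒≥ λ m<N →
          xm≢ym (prefixCode≡⇒agree N (toℕ-injective (trans x∈Yn (sym y∈Yn))) m m<N)) }

raisonnier-antitone : ∀ {X X′ a} → X′ ⊆C X → Raisonnier X a → Raisonnier X′ a
raisonnier-antitone X′⊆X (Y , cover , H[Y]⊆a) = Y , (λ x x∈X′ → cover x (X′⊆X x x∈X′)) , H[Y]⊆a

¬cofinite⇒false-above : LEM → ∀ {a} → ¬ Cofinite a → ∀ N → ∃ λ n → N ≤ n × a n ≡ false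
¬cofinite⇒false-above lem {a} ¬cofinite N with lem (∃ λ n → N ≤ n × a n ≡ false)
... | yes found = found
... | no  none  = contradiction (N , true-above) ¬cofinite
  where
  true-above : ∀ n → N ≤ n → a n ≡ true
  true-above n N≤n with a n in an≡
  ... | true  = refl
  ... | false = contradiction (n , N≤n , an≡) none

limit : (ℕ → Cantor) → Cantor
limit σ i = σ (suc i) i

module Limit (b : ℕ → ℕ) (b-increasing : ∀ k → b k < b (suc k))
             (σ : ℕ → Cantor) (σ-settles : ∀ k → Agree (b k) (σ (suc k)) (σ k)) where

  b-monotone : ∀ {k j} → k ≤′ j → b k ≤ b j
  b-monotone ≤′-refl        = ≤-refl
  b-monotone (≤′-step k≤′j) = ≤-trans (b-monotone k≤′j) (<⇒≤ (b-increasing _))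

  b-inflationary : ∀ k → k ≤ b k
  b-inflationary zero    = z≤n
  b-inflationary (suc k) = ≤-trans (s≤s (b-inflationary k)) (b-increasing k)

  σ-coherent : ∀ {k j} → k ≤′ j → Agree (b k) (σ j) (σ k)
  σ-coherent ≤′-refl                 i _    = refl
  σ-coherent (≤′-step {j} k≤′j) i i<bk =
    trans (σ-settles j i (<-≤-trans i<bk (b-monotone k≤′j))) (σ-coherent k≤′j i i<bk)

  limit-agree : ∀ k → Agree (b k) (limit σ) (σ k)
  limit-agree k i i<bk with ≤-total (suc i) k
  ... | inj₁ 1+i≤k = sym (σ-coherent (≤⇒≤′ 1+i≤k) i (b-inflationary (suc i)))
  ... | inj₂ k≤1+i = σ-coherent (≤⇒≤′ k≤1+i) i i<bk

module Diagonal (lem : LEM) (s : List Bool) {a : Subω} (¬cofinite : ¬ Cofinite a)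
                (Y : ℕ → SubsetC) (H[Y]⊆a : ∀ n m → H (Y n) m → a m ≡ true) where

  false-above : ∀ N → ∃ λ n → N ≤ n × a n ≡ false
  false-above = ¬cofinite⇒false-above lem ¬cofinite

  b : ℕ → ℕ
  b zero    = proj₁ (false-above (length s))
  b (suc k) = proj₁ (false-above (suc (b k)))

  |s|≤b₀ : length s ≤ b 0
  |s|≤b₀ = proj₁ (proj₂ (false-above (length s)))

  b-increasing : ∀ k → b k < b (suc k)
  b-increasing k = proj₁ (proj₂ (false-above (suc (b k))))

  a∘b≡false : ∀ k → a (b k) ≡ false
  a∘b≡false zero    = proj₂ (proj₂ (false-above (length s)))
  a∘b≡false (suc k) = proj₂ (proj₂ (false-above (suc (b k))))

  Rival : ℕ → Cantor → Set
  Rival k z = Σ Cantor λ y → Y k y × Agree (b k) y z × y (b k) ≡ true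

  stage : ℕ → Cantor
  stage zero    = s ++ᶜ (λ _ → false)
  stage (suc k) = update (stage k) (b k) (not (does (lem (Rival k (stage k)))))

  stage-settles : ∀ k → Agree (b k) (stage (suc k)) (stage k)
  stage-settles k i i<bk = update-other (stage k) (b k) _ i (<⇒≢ i<bk)

  open Limit b b-increasing stage stage-settles

  x : Cantor
  x = limit stage

  x-at-b : ∀ k → x (b k) ≡ not (does (lem (Rival k (stage k))))
  x-at-b k = trans (limit-agree (suc k) (b k) (b-increasing k)) (update-same (stage k) (b k) _)

  x∈cone : Cone s x
  x∈cone = extends-agree s (extends-++ᶜ s _)
    (λ i i<|s| → sym (limit-agree 0 i (<-≤-trans i<|s| |s|≤b₀)))

  x∉Y : ∀ n → ¬ Y n x
  x∉Y n x∈Yn with lem (Rival n (stage n))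
  ... | yes rival@(y , y∈Yn , y≈stage , yb≡true) =
    contradiction (trans (sym (a∘b≡false n)) (H[Y]⊆a n (b n) (x , y , x∈Yn , y∈Yn , h≡b))) λ ()
    where
    xb≡false : x (b n) ≡ false
    xb≡false = trans (x-at-b n) (cong not (dec-true (lem (Rival n (stage n))) rival))
    h≡b : IsH x y (b n)
    h≡b = agree⇒IsH (λ i i<bn → trans (limit-agree n i i<bn) (sym (y≈stage i i<bn)))
                    (λ xb≡yb → contradiction (trans (sym xb≡false) (trans xb≡yb yb≡true)) λ ())
  ... | no ¬rival =
    ¬rival (x , x∈Yn , limit-agree n ,
            trans (x-at-b n) (cong not (dec-false (lem (Rival n (stage n))) ¬rival)))

cone-escapes : LEM → ∀ s {a} → ¬ Cofinite a → (Y : ℕ → SubsetC) →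
               (∀ n m → H (Y n) m → a m ≡ true) → Σ Cantor λ x → Cone s x × (∀ n → ¬ Y n x)
cone-escapes lem s ¬cofinite Y H[Y]⊆a = x , x∈cone , x∉Y
  where open Diagonal lem s ¬cofinite Y H[Y]⊆a

raisonnier-cone⇒cofinite : LEM → ∀ s {a} → Raisonnier (Cone s) a → Cofinite a
raisonnier-cone⇒cofinite lem s {a} (Y , cover , H[Y]⊆a) with lem (Cofinite a)
... | yes cofinite  = cofinite
... | no  ¬cofinite =
  let (x , x∈cone , x∉Y) = cone-escapes lem s ¬cofinite Y H[Y]⊆a
      (n , x∈Yn)         = cover x x∈cone
  in contradiction x∈Yn (x∉Y n)

cone⊆⇒isFrechet : LEM → ∀ {X} s → Cone s ⊆C X → IsFrechet X
cone⊆⇒isFrechet lem {X} s cone⊆X a =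
  (λ a∈F → raisonnier-cone⇒cofinite lem s (raisonnier-antitone cone⊆X a∈F)) ,
  cofinite⇒raisonnier X

open-nonempty⇒cone⊆ : ∀ {X} → IsOpen X → Nonempty X → Σ (List Bool) λ s → Cone s ⊆C X
open-nonempty⇒cone⊆ X-open (x , x∈X) = let (s , _ , cone⊆X) = X-open x x∈X in s , cone⊆X

interior-nonempty⇒cone⊆ : ∀ {X} → NonemptyInterior X → Σ (List Bool) λ s → Cone s ⊆C X
interior-nonempty⇒cone⊆ (x , U , U-open , x∈U , U⊆X) =
  let (s , cone⊆U) = open-nonempty⇒cone⊆ U-open (x , x∈U) in s , λ z z∈cone → U⊆X z (cone⊆U z z∈cone)

corollary3p8 : LEM →
    ((s : List Bool) → IsFrechet (Cone s))
    × ((X : SubsetC) → IsOpen X → Nonempty X → IsFrechet X)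
    × ((X : SubsetC) → NonemptyInterior X → IsFrechet X)
corollary3p8 lem =
  (λ s → cone⊆⇒isFrechet lem s λ _ x∈cone → x∈cone) ,
  (λ X X-open X-nonempty → let (s , cone⊆X) = open-nonempty⇒cone⊆ X-open X-nonempty
                           in cone⊆⇒isFrechet lem s cone⊆X) ,
  (λ X X°-nonempty → let (s , cone⊆X) = interior-nonempty⇒cone⊆ X°-nonempty
                     in cone⊆⇒isFrechet lem s cone⊆X)
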